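{- Let $\mu$ be the uniform distribution on $S^n_{\lceil n/2\rceil}=\{x\in\{0,1\}^n : x\text{ has exactly }\lceil n/2\rceil\text{ ones}\}$. Then $D^+(\textsc{Maj}_n)=D^+_\mu(\textsc{Maj}_n)$.
   Context: $\textsc{Maj}_n(x)=1$ iff the number of ones in $x\in\{0,1\}^n$ is at least $n/2$. A monotone CNF formula is an AND of clauses each of which is an OR of (un-negated) variables; its size $|\phi|$ is its number of clauses. For $f\colon\{0,1\}^n\to\{0,1\}$ and a distribution $\mu$ on $f^{ -1}(1)$, $D^+_\mu(f):=\max_\phi \Pr_{x\sim\mu}[\phi(x)=1]/|\phi|$, the maximum over all monotone CNF formulas $\phi$ with $\phi^{ -1}(1)\subseteq f^{ -1}(1)$ (with $0/0=0$), and $D^+(f):=\min_\mu D^+_\mu(f)$ over all distributions $\mu$ on $f^{ -1}(1)$.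
   Formalization: The distributions on $f^{ -1}(1)$ in the minimum defining $D^+(\textsc{Maj}_n)$ take only rational values, rather than values in [0,1]. -}

module Defs where

open import Data.Bool using (Bool; true; false; if_then_else_)
open import Data.Nat using (ℕ; zero; suc; _*_; _≤ᵇ_; _≡ᵇ_; ⌈_/2⌉)
open import Data.Fin using (Fin)
open import Data.Vec using (Vec; []; _∷_; lookup)
open import Data.List using (List; []; _∷_; map; _++_; length; foldr; filter)
open import Data.Bool.ListAction using (all; any)
open import Data.Integer using (+_)
open import Data.Rational using (ℚ; 0ℚ; _+_; _*_; _/_; _≤_)
open import Data.Product using (Σ; _×_; ∃)
open import Relation.Binary.PropositionalEquality using (_≡_)

allInputs : (n : ℕ) → List (Vec Bool n)
allInputs zero = [] ∷ []
allInputs (suc n) = map (true ∷_) (allInputs n) ++ map (false ∷_) (allInputs n)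

ones : ∀ {n} → Vec Bool n → ℕ
ones [] = 0
ones (true ∷ x) = suc (ones x)
ones (false ∷ x) = ones x

Maj : (n : ℕ) → Vec Bool n → Bool
Maj n x = n ≤ᵇ (2 Data.Nat.* ones x)

-- monotone CNF over n variables: a list of clauses, each a list of variables
CNF : ℕ → Set
CNF n = List (List (Fin n))

evalCNF : ∀ {n} → CNF n → Vec Bool n → Bool
evalCNF φ x = all (λ c → any (λ i → lookup x i) c) φ

size : ∀ {n} → CNF n → ℕ
size φ = length φ

sumℚ : List ℚ → ℚ
sumℚ = foldr _+_ 0ℚ

record Distribution {n : ℕ} (f : Vec Bool n → Bool) : Set where
  field
    mass     : Vec Bool n → ℚ
    nonneg   : ∀ x → 0ℚ ≤ mass x
    support  : ∀ x → f x ≡ false → mass x ≡ 0ℚ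
    total    : sumℚ (map mass (allInputs n)) ≡ Data.Rational.1ℚ
open Distribution public

Pr : ∀ {n} {f : Vec Bool n → Bool} → Distribution f → CNF n → ℚ
Pr {n} μ φ = sumℚ (map (λ x → if evalCNF φ x then mass μ x else 0ℚ) (allInputs n))

-- Pr/|φ| with the convention 0/0 = 0
ratio : ∀ {n} {f : Vec Bool n → Bool} → Distribution f → CNF n → ℚ
ratio μ [] = 0ℚ
ratio μ (c ∷ cs) = Pr μ (c ∷ cs) Data.Rational.* ((+ 1) / suc (length cs))

Valid : ∀ {n} → (Vec Bool n → Bool) → CNF n → Set
Valid f φ = ∀ x → evalCNF φ x ≡ true → f x ≡ true

IsDPlusμ : ∀ {n} (f : Vec Bool n → Bool) → Distribution f → ℚ → Set
IsDPlusμ f μ d = (Σ (CNF _) λ φ → Valid f φ × ratio μ φ ≡ d)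
               × (∀ φ → Valid f φ → ratio μ φ ≤ d)

IsDPlus : ∀ {n} (f : Vec Bool n → Bool) → ℚ → Set
IsDPlus f d = (Σ (Distribution f) λ μ → IsDPlusμ f μ d)
            × (∀ (ν : Distribution f) d' → IsDPlusμ f ν d' → d ≤ d')

-- 1/k with 1/0 := 0
inv : ℕ → ℚ
inv zero = 0ℚ
inv (suc k) = (+ 1) / suc k

inLayer : (n : ℕ) → Vec Bool n → Bool
inLayer n x = ones x ≡ᵇ ⌈ n /2⌉

uniformMass : (n : ℕ) → Vec Bool n → ℚ
uniformMass n x = if inLayer n x
                  then inv (length (filter (λ y → Data.Bool.T? (inLayer n y)) (allInputs n)))
                  else 0ℚ

-- The maximum defining D⁺_μ(f) exists because a CNF can be replaced by the set of distinct
-- variable sets of its clauses: this computes the same function with at most as many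
-- clauses, and there are only finitely many such normal forms.
--
-- Let φ be optimal for the uniform distribution μ on the layer of weight k = ⌈n/2⌉ and let ν
-- be any distribution on Maj⁻¹(1). Averaging over the n! relabellings π of the variables,
--   ∑_π Pr_ν[φ∘π] = ∑_x ν(x) · #{π : φ(πx)}.
-- Every x with Maj(x) = 1 lies above a point x₀ of the layer, so by monotonicity
-- #{π : φ(πx)} ≥ #{π : φ(πx₀)} = n! · Pr_μ[φ], as πx₀ is uniform on the layer when π is
-- (each point of the layer is hit k!(n−k)! times). Hence some φ∘π, which is still valid
-- because Maj is symmetric, satisfies Pr_ν[φ∘π] ≥ Pr_μ[φ] with the same number of clauses.
module Submission where

open import Defs
open import Data.Product using (Σ; _×_)
open import Data.Rational using (ℚ)
open import Data.Nat using (ℕ)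
open import Relation.Binary.PropositionalEquality using (_≡_)

open import Algebra.Bundles using (CommutativeSemigroup)
import Algebra.Properties.CommutativeSemigroup as CommutativeSemigroupProperties
open import Algebra.Structures using (IsCommutativeSemiring; IsCommutativeRing)
open import Data.Bool using (Bool; true; false; if_then_else_; _∧_; T; T?)
open import Data.Bool.ListAction using (all; any; and; or)
import Data.Bool.Properties as BoolP
open import Data.Empty using (⊥-elim)
open import Data.Fin using (Fin; zero; suc)
import Data.Fin.Properties as FinP
import Data.Integer as ℤ
import Data.Integer.Properties as ℤP
open import Data.List as List using (List; []; _∷_; _++_; map; foldr; length; concat; filter)
import Data.List.Properties as ListP
import Data.List.Membership.DecPropositional as DecMembership
open import Data.List.Membership.Propositional using (_∈_)
open import Data.List.Membership.Propositional.Properties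
  using (∈-map⁺; ∈-map⁻; ∈-++⁺ˡ; ∈-++⁺ʳ; ∈-concat⁻′; ∈-filter⁺; ∈-filter⁻; ∈-allFin)
open import Data.List.Relation.Unary.All as All using (All)
import Data.List.Relation.Unary.All.Properties as AllP
open import Data.List.Relation.Unary.Any as Any using (here; there)
import Data.List.Relation.Unary.Any.Properties as AnyP
import Data.List.Relation.Binary.Subset.Propositional.Properties as SubsetP
open import Data.Nat as ℕ using (zero; suc; _+_; _*_; _∸_; _!; z≤n; s≤s; ⌈_/2⌉)
import Data.Nat.Properties as ℕP
open import Data.Nat.Coprimality as Coprime using (1-coprimeTo)
open import Data.Product using (∃; _,_; proj₂)
open import Data.Rational as ℚ using (0ℚ; 1ℚ; mkℚ)
import Data.Rational.Properties as ℚP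
open import Data.Vec as Vec using (Vec; []; _∷_; lookup; removeAt; allFin; tabulate)
import Data.Vec.Properties as VecP
open import Function using (_∘_; _⇔_; mk⇔; Equivalence)
open import Relation.Binary.Bundles using (DecTotalOrder)
open import Relation.Binary.Definitions using (DecidableEquality)
open import Relation.Binary.PropositionalEquality
  using (_≢_; refl; sym; trans; cong; cong₂; subst; subst₂; module ≡-Reasoning)
open import Relation.Nullary using (Dec; yes; no; does; isYes)
open import Relation.Nullary.Decidable using (toWitness; fromWitness; map′; _→-dec_)
open import Relation.Unary using (Decidable)

open import Data.List.Extrema (DecTotalOrder.totalOrder ℚP.≤-decTotalOrder)
  using (argmax; argmax-all; f[xs]≤f[argmax])

private variable B C : Set

fromℕ : ℕ → ℚ
fromℕ n = mkℚ (ℤ.+ n) 0 (Coprime.sym (1-coprimeTo n))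

fromℕ≡n/1 : ∀ n → fromℕ n ≡ (ℤ.+ n) ℚ./ 1
fromℕ≡n/1 n = sym (ℚP.↥p/↧p≡p (fromℕ n))

fromℕ-+ : ∀ m n → fromℕ (m + n) ≡ fromℕ m ℚ.+ fromℕ n
fromℕ-+ m n = trans (fromℕ≡n/1 (m + n))
  (cong (ℚ._/ 1) (sym (cong₂ ℤ._+_ (ℤP.*-identityʳ (ℤ.+ m)) (ℤP.*-identityʳ (ℤ.+ n)))))

fromℕ-* : ∀ m n → fromℕ (m * n) ≡ fromℕ m ℚ.* fromℕ n
fromℕ-* m n = trans (fromℕ≡n/1 (m * n)) (cong (ℚ._/ 1) (ℤP.pos-* m n))

fromℕ-suc-* : ∀ m q → fromℕ (suc m) ℚ.* q ≡ q ℚ.+ fromℕ m ℚ.* q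
fromℕ-suc-* m q = trans (cong (ℚ._* q) (fromℕ-+ 1 m))
  (trans (ℚP.*-distribʳ-+ q 1ℚ (fromℕ m)) (cong (ℚ._+ fromℕ m ℚ.* q) (ℚP.*-identityˡ q)))

fromℕ-mono-≤ : ∀ {m n} → m ℕ.≤ n → fromℕ m ℚ.≤ fromℕ n
fromℕ-mono-≤ {m} {n} m≤n = ℚ.*≤*
  (subst₂ ℤ._≤_ (sym (ℤP.*-identityʳ (ℤ.+ m))) (sym (ℤP.*-identityʳ (ℤ.+ n))) (ℤ.+≤+ m≤n))

inv-suc≡mkℚ : ∀ k → inv (suc k) ≡ mkℚ (ℤ.+ 1) k (1-coprimeTo (suc k))
inv-suc≡mkℚ k = ℚP.↥p/↧p≡p (mkℚ (ℤ.+ 1) k (1-coprimeTo (suc k)))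

fromℕ*inv : ∀ k → fromℕ (suc k) ℚ.* inv (suc k) ≡ 1ℚ
fromℕ*inv k = trans (cong (fromℕ (suc k) ℚ.*_) (inv-suc≡mkℚ k)) (ℚP.*-inverseʳ (fromℕ (suc k)))

inv-nonNeg : ∀ k → 0ℚ ℚ.≤ inv k
inv-nonNeg zero    = ℚP.≤-refl
inv-nonNeg (suc k) = ℚP.nonNegative⁻¹ _ {{ℚP.normalize-nonNeg 1 (suc k)}}

inv-antitone : ∀ {m n} → m ℕ.≤ n → inv (suc n) ℚ.≤ inv (suc m)
inv-antitone {m} {n} m≤n = subst₂ ℚ._≤_ (sym (inv-suc≡mkℚ n)) (sym (inv-suc≡mkℚ m))
  (ℚ.*≤* (ℤ.+≤+ (s≤s (subst₂ ℕ._≤_ (sym (ℕP.+-identityʳ m)) (sym (ℕP.+-identityʳ n)) m≤n))))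

module ListSum {A : Set} {_+_ _*_ : A → A → A} {0# 1# : A}
  (isCommutativeSemiring : IsCommutativeSemiring _≡_ _+_ _*_ 0# 1#) where

  open IsCommutativeSemiring isCommutativeSemiring
    using (+-assoc; +-identityˡ; +-isCommutativeSemigroup; distribˡ; zeroʳ; *-comm)

  +-commutativeSemigroup : CommutativeSemigroup _ _
  +-commutativeSemigroup = record { isCommutativeSemigroup = +-isCommutativeSemigroup }

  open CommutativeSemigroupProperties +-commutativeSemigroup using (interchange)

  ∑ : (B → A) → List B → A
  ∑ f xs = foldr _+_ 0# (map f xs)

  ∑-cong : ∀ {f g : B → A} → (∀ x → f x ≡ g x) → ∀ xs → ∑ f xs ≡ ∑ g xs
  ∑-cong f≗g []       = refl
  ∑-cong f≗g (x ∷ xs) = cong₂ _+_ (f≗g x) (∑-cong f≗g xs)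

  ∑-++ : ∀ (f : B → A) xs ys → ∑ f (xs ++ ys) ≡ ∑ f xs + ∑ f ys
  ∑-++ f []       ys = sym (+-identityˡ _)
  ∑-++ f (x ∷ xs) ys = trans (cong (f x +_) (∑-++ f xs ys)) (sym (+-assoc _ _ _))

  ∑-map : ∀ (f : B → A) (g : C → B) xs → ∑ f (map g xs) ≡ ∑ (f ∘ g) xs
  ∑-map f g []       = refl
  ∑-map f g (x ∷ xs) = cong (f (g x) +_) (∑-map f g xs)

  ∑-concat : ∀ (f : B → A) xss → ∑ f (concat xss) ≡ ∑ (∑ f) xss
  ∑-concat f []         = refl
  ∑-concat f (xs ∷ xss) = trans (∑-++ f xs (concat xss)) (cong (∑ f xs +_) (∑-concat f xss))

  ∑-0 : ∀ (xs : List B) → ∑ (λ _ → 0#) xs ≡ 0#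
  ∑-0 []       = refl
  ∑-0 (x ∷ xs) = trans (cong (0# +_) (∑-0 xs)) (+-identityˡ 0#)

  ∑-+ : ∀ (f g : B → A) xs → ∑ (λ x → f x + g x) xs ≡ ∑ f xs + ∑ g xs
  ∑-+ f g []       = sym (+-identityˡ 0#)
  ∑-+ f g (x ∷ xs) = trans (cong ((f x + g x) +_) (∑-+ f g xs)) (interchange _ _ _ _)

  ∑-swap : ∀ (g : B → C → A) xs ys → ∑ (λ x → ∑ (g x) ys) xs ≡ ∑ (λ y → ∑ (λ x → g x y) xs) ys
  ∑-swap g []       ys = sym (∑-0 ys)
  ∑-swap g (x ∷ xs) ys = trans (cong (∑ (g x) ys +_) (∑-swap g xs ys))
                               (sym (∑-+ (g x) (λ y → ∑ (λ x′ → g x′ y) xs) ys))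

  ∑-distribˡ : ∀ c (f : B → A) xs → ∑ (λ x → c * f x) xs ≡ c * ∑ f xs
  ∑-distribˡ c f []       = sym (zeroʳ c)
  ∑-distribˡ c f (x ∷ xs) = trans (cong ((c * f x) +_) (∑-distribˡ c f xs)) (sym (distribˡ c (f x) _))

  ∑-distribʳ : ∀ c (f : B → A) xs → ∑ (λ x → f x * c) xs ≡ ∑ f xs * c
  ∑-distribʳ c f xs = trans (∑-cong (λ x → *-comm (f x) c) xs) (trans (∑-distribˡ c f xs) (*-comm c _))

module Sumℕ = ListSum ℕP.+-*-isCommutativeSemiring
module Sumℚ = ListSum (IsCommutativeRing.isCommutativeSemiring ℚP.+-*-isCommutativeRing)

open Sumℕ using () renaming (∑ to ∑ℕ)
open Sumℚ using () renaming (∑ to ∑ℚ)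

∑ℕ-mono-≤ : ∀ {f g : B → ℕ} → (∀ x → f x ℕ.≤ g x) → ∀ xs → ∑ℕ f xs ℕ.≤ ∑ℕ g xs
∑ℕ-mono-≤ f≤g []       = z≤n
∑ℕ-mono-≤ f≤g (x ∷ xs) = ℕP.+-mono-≤ (f≤g x) (∑ℕ-mono-≤ f≤g xs)

∑ℚ-mono-≤ : ∀ {f g : B → ℚ} → (∀ x → f x ℚ.≤ g x) → ∀ xs → ∑ℚ f xs ℚ.≤ ∑ℚ g xs
∑ℚ-mono-≤ f≤g []       = ℚP.≤-refl
∑ℚ-mono-≤ f≤g (x ∷ xs) = ℚP.+-mono-≤ (f≤g x) (∑ℚ-mono-≤ f≤g xs)

∑ℚ-nonNeg : ∀ {f : B → ℚ} → (∀ x → 0ℚ ℚ.≤ f x) → ∀ xs → 0ℚ ℚ.≤ ∑ℚ f xs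
∑ℚ-nonNeg {f = f} 0≤f xs = subst (ℚ._≤ ∑ℚ f xs) (Sumℚ.∑-0 xs) (∑ℚ-mono-≤ 0≤f xs)

∑ℚ-≤-length* : ∀ (f : B → ℚ) q xs → All (λ x → f x ℚ.≤ q) xs → ∑ℚ f xs ℚ.≤ fromℕ (length xs) ℚ.* q
∑ℚ-≤-length* f q []       All.[]               = ℚP.≤-reflexive (sym (ℚP.*-zeroˡ q))
∑ℚ-≤-length* f q (x ∷ xs) (fx≤q All.∷ fxs≤q) =
  subst (∑ℚ f (x ∷ xs) ℚ.≤_) (sym (fromℕ-suc-* (length xs) q)) (ℚP.+-mono-≤ fx≤q (∑ℚ-≤-length* f q xs fxs≤q))

indicator : Bool → ℕ
indicator true  = 1
indicator false = 0

indicator-mono : ∀ {a b} → (T a → T b) → indicator a ℕ.≤ indicator b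
indicator-mono {false}         _   = z≤n
indicator-mono {true} {true}   _   = s≤s z≤n
indicator-mono {true} {false} a⇒b = ⊥-elim (a⇒b _)

indicator-∧ : ∀ a b → indicator (a ∧ b) ≡ indicator a * indicator b
indicator-∧ true  b = sym (ℕP.*-identityˡ (indicator b))
indicator-∧ false b = refl

count : (B → Bool) → List B → ℕ
count p = ∑ℕ (indicator ∘ p)

count-true≡length : ∀ (xs : List B) → count (λ _ → true) xs ≡ length xs
count-true≡length []       = refl
count-true≡length (x ∷ xs) = cong suc (count-true≡length xs)

count-false≡0 : ∀ (xs : List B) → count (λ _ → false) xs ≡ 0
count-false≡0 = Sumℕ.∑-0

∈⇒count≡suc : ∀ {p : B → Bool} {x xs} → x ∈ xs → T (p x) → ∃ λ k → count p xs ≡ suc k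
∈⇒count≡suc {p = p} {xs = y ∷ ys} (here refl) px with p y
... | true = count p ys , refl
∈⇒count≡suc {p = p} {xs = y ∷ ys} (there x∈) px with p y | ∈⇒count≡suc {p = p} x∈ px
... | true  | _      = count p ys , refl
... | false | k , eq = k , eq

length-filter≡count : ∀ {P : B → Set} (P? : Decidable P) xs → length (filter P? xs) ≡ count (does ∘ P?) xs
length-filter≡count P? []       = refl
length-filter≡count P? (x ∷ xs) with does (P? x)
... | true  = cong suc (length-filter≡count P? xs)
... | false = length-filter≡count P? xs

∑ℚ-if : ∀ (p : B → Bool) q xs → ∑ℚ (λ x → if p x then q else 0ℚ) xs ≡ fromℕ (count p xs) ℚ.* q
∑ℚ-if p q []       = sym (ℚP.*-zeroˡ q)
∑ℚ-if p q (x ∷ xs) with p x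
... | true  = trans (cong (q ℚ.+_) (∑ℚ-if p q xs)) (sym (fromℕ-suc-* (count p xs) q))
... | false = trans (ℚP.+-identityˡ _) (∑ℚ-if p q xs)

module Enumeration {A : Set} (_≟_ : DecidableEquality A) where

  open DecMembership _≟_ public using (_∈?_)

  _≡ᵇ_ : A → A → Bool
  x ≡ᵇ y = does (x ≟ y)

  ≡ᵇ-sym : ∀ x y → x ≡ᵇ y ≡ y ≡ᵇ x
  ≡ᵇ-sym x y with x ≟ y | y ≟ x
  ... | yes _   | yes _   = refl
  ... | no  _   | no  _   = refl
  ... | yes x≡y | no  y≢x = ⊥-elim (y≢x (sym x≡y))
  ... | no  x≢y | yes y≡x = ⊥-elim (x≢y (sym y≡x))

  count-≡ᵇ-∉ : ∀ y xs → (∀ {x} → x ∈ xs → x ≢ y) → count (_≡ᵇ y) xs ≡ 0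
  count-≡ᵇ-∉ y []       ∉xs = refl
  count-≡ᵇ-∉ y (x ∷ xs) ∉xs with x ≟ y
  ... | yes x≡y = ⊥-elim (∉xs (here refl) x≡y)
  ... | no  _   = count-≡ᵇ-∉ y xs (∉xs ∘ there)

  record Enumerates (us : List A) : Set where
    constructor enumerates
    field occurs-once : ∀ x → count (x ≡ᵇ_) us ≡ 1
  open Enumerates

  module _ {us : List A} (enum : Enumerates us) where

    ∑-delta : ∀ x (h : A → ℕ) → ∑ℕ (λ y → indicator (x ≡ᵇ y) * h y) us ≡ h x
    ∑-delta x h = begin
      ∑ℕ (λ y → indicator (x ≡ᵇ y) * h y) us ≡⟨ Sumℕ.∑-cong only-x us ⟩
      ∑ℕ (λ y → indicator (x ≡ᵇ y) * h x) us ≡⟨ Sumℕ.∑-distribʳ (h x) (indicator ∘ (x ≡ᵇ_)) us ⟩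
      count (x ≡ᵇ_) us * h x                 ≡⟨ cong (_* h x) (occurs-once enum x) ⟩
      1 * h x                                ≡⟨ ℕP.*-identityˡ (h x) ⟩
      h x                                    ∎
      where
      open ≡-Reasoning
      only-x : ∀ y → indicator (x ≡ᵇ y) * h y ≡ indicator (x ≡ᵇ y) * h x
      only-x y with x ≟ y
      ... | yes refl = refl
      ... | no  _    = refl

    ∑-fibres : ∀ (h : A → ℕ) xs → ∑ℕ h xs ≡ ∑ℕ (λ y → count (_≡ᵇ y) xs * h y) us
    ∑-fibres h xs = begin
      ∑ℕ h xs                                              ≡⟨ Sumℕ.∑-cong (λ x → sym (∑-delta x h)) xs ⟩
      ∑ℕ (λ x → ∑ℕ (λ y → indicator (x ≡ᵇ y) * h y) us) xs ≡⟨ Sumℕ.∑-swap _ xs us ⟩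
      ∑ℕ (λ y → ∑ℕ (λ x → indicator (x ≡ᵇ y) * h y) xs) us ≡⟨ Sumℕ.∑-cong (λ y → Sumℕ.∑-distribʳ (h y) _ xs) us ⟩
      ∑ℕ (λ y → count (_≡ᵇ y) xs * h y) us                 ∎
      where open ≡-Reasoning

    count-∈?-≤ : ∀ xs → count (λ y → does (y ∈? xs)) us ℕ.≤ length xs
    count-∈?-≤ xs = begin
      count (λ y → does (y ∈? xs)) us ≤⟨ ∑ℕ-mono-≤ (λ y → ∈?-≤-count y xs) us ⟩
      ∑ℕ (λ y → count (y ≡ᵇ_) xs) us  ≡⟨ Sumℕ.∑-swap _ us xs ⟩
      ∑ℕ (λ x → count (_≡ᵇ x) us) xs  ≡⟨ Sumℕ.∑-cong occurs-once′ xs ⟩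
      count (λ _ → true) xs           ≡⟨ count-true≡length xs ⟩
      length xs                       ∎
      where
      open ℕP.≤-Reasoning
      ∈?-≤-count : ∀ y xs → indicator (does (y ∈? xs)) ℕ.≤ count (y ≡ᵇ_) xs
      ∈?-≤-count y []       = z≤n
      ∈?-≤-count y (x ∷ xs) with y ≡ᵇ x
      ... | true  = s≤s z≤n
      ... | false = ∈?-≤-count y xs
      occurs-once′ : ∀ x → count (_≡ᵇ x) us ≡ 1
      occurs-once′ x = trans (Sumℕ.∑-cong (λ y → cong indicator (≡ᵇ-sym y x)) us) (occurs-once enum x)

module Cube {n : ℕ} = Enumeration (VecP.≡-dec {n = n} BoolP._≟_)
open Cube using (_≡ᵇ_; _∈?_; Enumerates; count-≡ᵇ-∉)

count-≡ᵇ-allInputs : ∀ {n} (x : Vec Bool n) → count (x ≡ᵇ_) (allInputs n) ≡ 1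
count-≡ᵇ-allInputs             []      = refl
count-≡ᵇ-allInputs {suc n} (b ∷ x) = begin
  count ((b ∷ x) ≡ᵇ_) (map (true ∷_) us ++ map (false ∷_) us)
    ≡⟨ Sumℕ.∑-++ _ (map (true ∷_) us) (map (false ∷_) us) ⟩
  count ((b ∷ x) ≡ᵇ_) (map (true ∷_) us) + count ((b ∷ x) ≡ᵇ_) (map (false ∷_) us)
    ≡⟨ cong₂ _+_ (Sumℕ.∑-map _ (true ∷_) us) (Sumℕ.∑-map _ (false ∷_) us) ⟩
  count (λ y → does (b BoolP.≟ true) ∧ (x ≡ᵇ y)) us + count (λ y → does (b BoolP.≟ false) ∧ (x ≡ᵇ y)) us
    ≡⟨ one-half b ⟩
  1 ∎
  where
  open ≡-Reasoning
  us = allInputs n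
  one-half : ∀ b → count (λ y → does (b BoolP.≟ true) ∧ (x ≡ᵇ y)) us
                   + count (λ y → does (b BoolP.≟ false) ∧ (x ≡ᵇ y)) us ≡ 1
  one-half true  = cong₂ _+_ (count-≡ᵇ-allInputs x) (count-false≡0 us)
  one-half false = cong₂ _+_ (count-false≡0 us) (count-≡ᵇ-allInputs x)

allInputs-enumerates : ∀ n → Enumerates (allInputs n)
allInputs-enumerates n = Cube.enumerates count-≡ᵇ-allInputs

∈-allInputs : ∀ {n} (x : Vec Bool n) → x ∈ allInputs n
∈-allInputs []          = here refl
∈-allInputs (true ∷ x)  = ∈-++⁺ˡ (∈-map⁺ (true ∷_) (∈-allInputs x))
∈-allInputs (false ∷ x) = ∈-++⁺ʳ (map (true ∷_) (allInputs _)) (∈-map⁺ (false ∷_) (∈-allInputs x))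

ones-≤ : ∀ {n} (x : Vec Bool n) → ones x ℕ.≤ n
ones-≤ []          = z≤n
ones-≤ (true ∷ x)  = s≤s (ones-≤ x)
ones-≤ (false ∷ x) = ℕP.m≤n⇒m≤1+n (ones-≤ x)

ones-∷ : ∀ {n} b (x : Vec Bool n) → ones (b ∷ x) ≡ indicator b + ones x
ones-∷ true  x = refl
ones-∷ false x = refl

ones-removeAt : ∀ {n} (x : Vec Bool (suc n)) i → ones x ≡ indicator (lookup x i) + ones (removeAt x i)
ones-removeAt (b ∷ x)              zero    = ones-∷ b x
ones-removeAt (true  ∷ x@(_ ∷ _)) (suc i) = trans (cong suc (ones-removeAt x i)) (sym (ℕP.+-suc _ _))
ones-removeAt (false ∷ x@(_ ∷ _)) (suc i) = ones-removeAt x i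

ones-removeAt-cancel : ∀ {n} (x : Vec Bool (suc n)) {i b} (y : Vec Bool n) →
                       lookup x i ≡ b → ones (b ∷ y) ≡ ones x → ones (removeAt x i) ≡ ones y
ones-removeAt-cancel x {i} {b} y xᵢ≡b same-ones = ℕP.+-cancelˡ-≡ (indicator b) _ _ (begin
  indicator b + ones (removeAt x i)            ≡⟨ cong (λ c → indicator c + ones (removeAt x i)) xᵢ≡b ⟨
  indicator (lookup x i) + ones (removeAt x i) ≡⟨ ones-removeAt x i ⟨
  ones x                                       ≡⟨ same-ones ⟨
  ones (b ∷ y)                                 ≡⟨ ones-∷ b y ⟩
  indicator b + ones y                         ∎)
  where open ≡-Reasoning

∑ℕ-allFin-suc : ∀ {n} (f : Fin (suc n) → ℕ) → ∑ℕ f (List.allFin (suc n)) ≡ f zero + ∑ℕ (f ∘ suc) (List.allFin n)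
∑ℕ-allFin-suc {n} f = cong (f zero +_)
  (trans (cong (∑ℕ f) (sym (ListP.map-tabulate (λ i → i) suc))) (Sumℕ.∑-map f suc (List.allFin n)))

occurrences : ∀ {n} → Bool → Vec Bool n → ℕ
occurrences b x = count (λ i → does (lookup x i BoolP.≟ b)) (List.allFin _)

occurrences-∷ : ∀ {n} b c (x : Vec Bool n) → occurrences b (c ∷ x) ≡ indicator (does (c BoolP.≟ b)) + occurrences b x
occurrences-∷ b c x = ∑ℕ-allFin-suc (λ i → indicator (does (lookup (c ∷ x) i BoolP.≟ b)))

occurrences-true : ∀ {n} (x : Vec Bool n) → occurrences true x ≡ ones x
occurrences-true []          = refl
occurrences-true (true ∷ x)  = trans (occurrences-∷ true true x) (cong suc (occurrences-true x))
occurrences-true (false ∷ x) = trans (occurrences-∷ true false x) (occurrences-true x)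

occurrences-false : ∀ {n} (x : Vec Bool n) → occurrences false x ≡ n ∸ ones x
occurrences-false []          = refl
occurrences-false (true ∷ x)  = trans (occurrences-∷ false true x) (occurrences-false x)
occurrences-false (false ∷ x) = trans (occurrences-∷ false false x)
  (trans (cong suc (occurrences-false x)) (sym (ℕP.+-∸-assoc 1 (ones-≤ x))))

-- Arrangements and permutations

arrangements : ∀ {A : Set} {n} → Vec A n → List (Vec A n)
arrangements {n = zero}  [] = [] ∷ []
arrangements {n = suc n} x  =
  concat (map (λ i → map (lookup x i ∷_) (arrangements (removeAt x i))) (List.allFin (suc n)))

removeAt-map : ∀ {A B : Set} {n} (f : A → B) (x : Vec A (suc n)) i →
               removeAt (Vec.map f x) i ≡ Vec.map f (removeAt x i)
removeAt-map f (a ∷ x)          zero    = refl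
removeAt-map f (a ∷ x@(_ ∷ _)) (suc i) = cong (f a ∷_) (removeAt-map f x i)

map-arrangements : ∀ {A B : Set} {n} (f : A → B) (x : Vec A n) →
                   map (Vec.map f) (arrangements x) ≡ arrangements (Vec.map f x)
map-arrangements {n = zero}  f [] = refl
map-arrangements {n = suc n} f x  = begin
  map (Vec.map f) (concat (map branch fins))         ≡⟨ ListP.concat-map (map branch fins) ⟨
  concat (map (map (Vec.map f)) (map branch fins))   ≡⟨ cong concat (ListP.map-∘ fins) ⟨
  concat (map (map (Vec.map f) ∘ branch) fins)       ≡⟨ cong concat (ListP.map-cong map-branch fins) ⟩
  arrangements (Vec.map f x)                         ∎
  where
  open ≡-Reasoning
  fins = List.allFin (suc n)
  branch : Fin (suc n) → List (Vec _ (suc n))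
  branch i = map (lookup x i ∷_) (arrangements (removeAt x i))
  map-branch : ∀ i → map (Vec.map f) (branch i)
                     ≡ map (lookup (Vec.map f x) i ∷_) (arrangements (removeAt (Vec.map f x) i))
  map-branch i = begin
    map (Vec.map f) (map (lookup x i ∷_) rest)          ≡⟨ ListP.map-∘ rest ⟨
    map (λ w → f (lookup x i) ∷ Vec.map f w) rest       ≡⟨ ListP.map-∘ rest ⟩
    map (f (lookup x i) ∷_) (map (Vec.map f) rest)
      ≡⟨ cong (map (f (lookup x i) ∷_)) (map-arrangements f (removeAt x i)) ⟩
    map (f (lookup x i) ∷_) (arrangements (Vec.map f (removeAt x i)))
      ≡⟨ cong₂ (λ a r → map (a ∷_) (arrangements r)) (VecP.lookup-map i f x) (removeAt-map f x i) ⟨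
    map (lookup (Vec.map f x) i ∷_) (arrangements (removeAt (Vec.map f x) i)) ∎
    where rest = arrangements (removeAt x i)

∈-arrangements : ∀ {A : Set} {n} (x : Vec A n) → x ∈ arrangements x
∈-arrangements []      = here refl
∈-arrangements (a ∷ x) = ∈-++⁺ˡ (∈-map⁺ (a ∷_) (∈-arrangements x))

ones-arrangements : ∀ {n} (x w : Vec Bool n) → w ∈ arrangements x → ones w ≡ ones x
ones-arrangements {zero}  [] w (here refl) = refl
ones-arrangements {suc n} x  w w∈ with ∈-concat⁻′ (map _ (List.allFin (suc n))) w∈
... | ws , w∈ws , ws∈ with ∈-map⁻ _ ws∈
... | i , _ , refl with ∈-map⁻ (lookup x i ∷_) w∈ws
... | w′ , w′∈ , refl = begin
  ones (lookup x i ∷ w′)                       ≡⟨ ones-∷ (lookup x i) w′ ⟩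
  indicator (lookup x i) + ones w′             ≡⟨ cong (indicator (lookup x i) +_) (ones-arrangements _ w′ w′∈) ⟩
  indicator (lookup x i) + ones (removeAt x i) ≡⟨ ones-removeAt x i ⟨
  ones x                                       ∎
  where open ≡-Reasoning

stabiliserOrder : ℕ → ℕ → ℕ
stabiliserOrder n k = k ! * (n ∸ k) !

occurrences*stabiliserOrder : ∀ {n} b (x : Vec Bool (suc n)) (y : Vec Bool n) → ones (b ∷ y) ≡ ones x →
                              occurrences b x * stabiliserOrder n (ones y) ≡ stabiliserOrder (suc n) (ones x)
occurrences*stabiliserOrder {n} true x y same-ones rewrite occurrences-true x | sym same-ones =
  sym (ℕP.*-assoc (suc (ones y)) (ones y !) ((n ∸ ones y) !))
occurrences*stabiliserOrder {n} false x y same-ones rewrite occurrences-false x | sym same-ones = begin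
  (suc n ∸ k) * (k ! * (n ∸ k) !)   ≡⟨ cong (_* (k ! * (n ∸ k) !)) (ℕP.+-∸-assoc 1 (ones-≤ y)) ⟩
  suc (n ∸ k) * (k ! * (n ∸ k) !)   ≡⟨ x∙yz≈y∙xz (suc (n ∸ k)) (k !) ((n ∸ k) !) ⟩
  k ! * (suc (n ∸ k) * (n ∸ k) !)   ≡⟨ cong (λ m → k ! * m !) (ℕP.+-∸-assoc 1 (ones-≤ y)) ⟨
  k ! * (suc n ∸ k) !               ∎
  where
  open ≡-Reasoning
  open CommutativeSemigroupProperties ℕP.*-commutativeSemigroup using (x∙yz≈y∙xz)
  k = ones y

count-arrangements : ∀ {n} (x y : Vec Bool n) → ones y ≡ ones x →
                     count (_≡ᵇ y) (arrangements x) ≡ stabiliserOrder n (ones x)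
count-arrangements         [] []      _         = refl
count-arrangements {suc n} x  (b ∷ y) same-ones = begin
  count (_≡ᵇ (b ∷ y)) (arrangements x)                            ≡⟨ Sumℕ.∑-concat _ (map branch fins) ⟩
  ∑ℕ (count (_≡ᵇ (b ∷ y))) (map branch fins)                     ≡⟨ Sumℕ.∑-map _ branch fins ⟩
  ∑ℕ (λ i → count (_≡ᵇ (b ∷ y)) (branch i)) fins                 ≡⟨ Sumℕ.∑-cong count-branch fins ⟩
  ∑ℕ (λ i → indicator (xᵢ≡ᵇb i) * stabiliserOrder n (ones y)) fins ≡⟨ Sumℕ.∑-distribʳ _ (indicator ∘ xᵢ≡ᵇb) fins ⟩
  occurrences b x * stabiliserOrder n (ones y)                   ≡⟨ occurrences*stabiliserOrder b x y same-ones ⟩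
  stabiliserOrder (suc n) (ones x)                               ∎
  where
  open ≡-Reasoning
  fins = List.allFin (suc n)
  xᵢ≡ᵇb : Fin (suc n) → Bool
  xᵢ≡ᵇb i = does (lookup x i BoolP.≟ b)
  branch : Fin (suc n) → List (Vec Bool (suc n))
  branch i = map (lookup x i ∷_) (arrangements (removeAt x i))
  count-branch : ∀ i → count (_≡ᵇ (b ∷ y)) (branch i) ≡ indicator (xᵢ≡ᵇb i) * stabiliserOrder n (ones y)
  count-branch i = trans (Sumℕ.∑-map _ (lookup x i ∷_) (arrangements (removeAt x i))) (by-head (lookup x i BoolP.≟ b))
    where
    by-head : (d : Dec (lookup x i ≡ b)) → count (λ w → does d ∧ (w ≡ᵇ y)) (arrangements (removeAt x i))
                                           ≡ indicator (does d) * stabiliserOrder n (ones y)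
    by-head (no  _)    = count-false≡0 (arrangements (removeAt x i))
    by-head (yes xᵢ≡b) = begin
      count (_≡ᵇ y) (arrangements (removeAt x i)) ≡⟨ count-arrangements (removeAt x i) y (sym ones-rest) ⟩
      stabiliserOrder n (ones (removeAt x i))     ≡⟨ cong (stabiliserOrder n) ones-rest ⟩
      stabiliserOrder n (ones y)                  ≡⟨ ℕP.+-identityʳ _ ⟨
      1 * stabiliserOrder n (ones y)              ∎
      where ones-rest = ones-removeAt-cancel x y xᵢ≡b same-ones

∑-arrangements : ∀ {n} (x : Vec Bool n) (h : Vec Bool n → ℕ) →
                 ∑ℕ h (arrangements x)
                 ≡ stabiliserOrder n (ones x) * ∑ℕ (λ y → h y * indicator (ones y ℕ.≡ᵇ ones x)) (allInputs n)
∑-arrangements {n} x h = begin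
  ∑ℕ h (arrangements x)                                       ≡⟨ Cube.∑-fibres enum h (arrangements x) ⟩
  ∑ℕ (λ y → count (_≡ᵇ y) (arrangements x) * h y) us          ≡⟨ Sumℕ.∑-cong fibre us ⟩
  ∑ℕ (λ y → stab * (h y * indicator (ones y ℕ.≡ᵇ ones x))) us ≡⟨ Sumℕ.∑-distribˡ stab _ us ⟩
  stab * ∑ℕ (λ y → h y * indicator (ones y ℕ.≡ᵇ ones x)) us   ∎
  where
  open ≡-Reasoning
  us = allInputs n
  enum = allInputs-enumerates n
  stab = stabiliserOrder n (ones x)
  fibre : ∀ y → count (_≡ᵇ y) (arrangements x) * h y ≡ stab * (h y * indicator (ones y ℕ.≡ᵇ ones x))
  fibre y with ones y ℕ.≡ᵇ ones x in same
  ... | true  = trans (cong (_* h y) (count-arrangements x y (ℕP.≡ᵇ⇒≡ _ _ (subst T (sym same) _))))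
                      (cong (stab *_) (sym (ℕP.*-identityʳ (h y))))
  ... | false = trans (cong (_* h y) (count-≡ᵇ-∉ y (arrangements x) other-weight))
                      (sym (trans (cong (stab *_) (ℕP.*-zeroʳ (h y))) (ℕP.*-zeroʳ stab)))
    where
    other-weight : ∀ {w} → w ∈ arrangements x → w ≢ y
    other-weight w∈ refl = subst T same (ℕP.≡⇒≡ᵇ _ _ (ones-arrangements x _ w∈))

permutations : ∀ n → List (Vec (Fin n) n)
permutations n = arrangements (allFin n)

act : ∀ {n} → Vec (Fin n) n → Vec Bool n → Vec Bool n
act π x = Vec.map (lookup x) π

relabel : ∀ {n} → Vec (Fin n) n → CNF n → CNF n
relabel π φ = map (map (lookup π)) φ

map-act-permutations : ∀ {n} (x : Vec Bool n) → map (λ π → act π x) (permutations n) ≡ arrangements x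
map-act-permutations {n} x =
  trans (map-arrangements (lookup x) (allFin n)) (cong arrangements (VecP.map-lookup-allFin x))

∑-permutations : ∀ {n} (x : Vec Bool n) (h : Vec Bool n → ℕ) →
                 ∑ℕ (λ π → h (act π x)) (permutations n) ≡ ∑ℕ h (arrangements x)
∑-permutations {n} x h =
  trans (sym (Sumℕ.∑-map h (λ π → act π x) (permutations n))) (cong (∑ℕ h) (map-act-permutations x))

ones-act : ∀ {n} {π : Vec (Fin n) n} (x : Vec Bool n) → π ∈ permutations n → ones (act π x) ≡ ones x
ones-act {π = π} x π∈ = ones-arrangements x (act π x)
  (subst (act π x ∈_) (map-act-permutations x) (∈-map⁺ (λ π → act π x) π∈))

Maj-act : ∀ {n} {π : Vec (Fin n) n} (x : Vec Bool n) → π ∈ permutations n → Maj n (act π x) ≡ Maj n x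
Maj-act {n} x π∈ = cong (λ k → n ℕ.≤ᵇ 2 * k) (ones-act x π∈)

evalCNF-relabel : ∀ {n} (π : Vec (Fin n) n) (φ : CNF n) x → evalCNF (relabel π φ) x ≡ evalCNF φ (act π x)
evalCNF-relabel π φ x = trans (cong and (sym (ListP.map-∘ φ))) (cong and (ListP.map-cong clause φ))
  where
  clause : ∀ c → any (lookup x) (map (lookup π) c) ≡ any (lookup (act π x)) c
  clause c = trans (cong or (sym (ListP.map-∘ c)))
                   (cong or (ListP.map-cong (λ i → sym (VecP.lookup-map i (lookup x) π)) c))

Valid-relabel : ∀ {n} {f : Vec Bool n → Bool} π φ → (∀ x → f (act π x) ≡ f x) → Valid f φ → Valid f (relabel π φ)
Valid-relabel π φ f-invariant valid x φx =
  trans (sym (f-invariant x)) (valid (act π x) (trans (sym (evalCNF-relabel π φ x)) φx))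

_≤ᵛ_ : ∀ {n} → Vec Bool n → Vec Bool n → Set
x ≤ᵛ y = ∀ i → T (lookup x i) → T (lookup y i)

evalCNF-mono : ∀ {n} (φ : CNF n) {x y : Vec Bool n} → x ≤ᵛ y → T (evalCNF φ x) → T (evalCNF φ y)
evalCNF-mono φ {x} {y} x≤y =
  AllP.all⁻ (any (lookup y)) ∘ All.map (λ {c} → clause-mono {c}) ∘ AllP.all⁺ (any (lookup x)) φ
  where
  clause-mono : ∀ {c} → T (any (lookup x) c) → T (any (lookup y) c)
  clause-mono {c} = AnyP.any⁺ (lookup y) ∘ Any.map (λ {i} → x≤y i) ∘ AnyP.any⁻ (lookup x) c

act-mono : ∀ {n} (π : Vec (Fin n) n) {x y : Vec Bool n} → x ≤ᵛ y → act π x ≤ᵛ act π y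
act-mono π {x} {y} x≤y i =
  subst T (sym (VecP.lookup-map i (lookup y) π)) ∘ x≤y (lookup π i) ∘ subst T (VecP.lookup-map i (lookup x) π)

keepOnes : ∀ {n} → ℕ → Vec Bool n → Vec Bool n
keepOnes k       []          = []
keepOnes zero    (b ∷ x)     = false ∷ keepOnes zero x
keepOnes (suc k) (true ∷ x)  = true ∷ keepOnes k x
keepOnes (suc k) (false ∷ x) = false ∷ keepOnes (suc k) x

keepOnes-≤ᵛ : ∀ {n} k (x : Vec Bool n) → keepOnes k x ≤ᵛ x
keepOnes-≤ᵛ zero    (b ∷ x)     (suc i) = keepOnes-≤ᵛ zero x i
keepOnes-≤ᵛ (suc k) (true ∷ x)  zero    = _
keepOnes-≤ᵛ (suc k) (true ∷ x)  (suc i) = keepOnes-≤ᵛ k x i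
keepOnes-≤ᵛ (suc k) (false ∷ x) (suc i) = keepOnes-≤ᵛ (suc k) x i

ones-keepOnes : ∀ {n} k (x : Vec Bool n) → k ℕ.≤ ones x → ones (keepOnes k x) ≡ k
ones-keepOnes zero    []          _        = refl
ones-keepOnes zero    (b ∷ x)     _        = ones-keepOnes zero x z≤n
ones-keepOnes (suc k) (true ∷ x)  (s≤s k≤) = cong suc (ones-keepOnes k x k≤)
ones-keepOnes (suc k) (false ∷ x) k<       = ones-keepOnes (suc k) x k<

-- Normal forms of CNFs and the optimum defining D⁺_μ

T-ext : ∀ {a b} → (T a → T b) → (T b → T a) → a ≡ b
T-ext {false} {false} _   _   = refl
T-ext {false} {true}  _   b⇒a = ⊥-elim (b⇒a _)
T-ext {true}  {false} a⇒b _   = ⊥-elim (a⇒b _)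
T-ext {true}  {true}  _   _   = refl

module FinMembership {n} = DecMembership (FinP._≟_ {n})

clauseOf : ∀ {n} → Vec Bool n → List (Fin n)
clauseOf v = filter (T? ∘ lookup v) (List.allFin _)

characteristic : ∀ {n} → List (Fin n) → Vec Bool n
characteristic c = tabulate (λ i → isYes (i FinMembership.∈? c))

∈-clauseOf : ∀ {n} {i : Fin n} {v} → i ∈ clauseOf v ⇔ T (lookup v i)
∈-clauseOf {i = i} {v} = mk⇔ (proj₂ ∘ ∈-filter⁻ (T? ∘ lookup v) {xs = List.allFin _})
                             (∈-filter⁺ (T? ∘ lookup v) (∈-allFin i))

T-characteristic : ∀ {n} {i : Fin n} {c} → T (lookup (characteristic c) i) ⇔ i ∈ c
T-characteristic {i = i} {c} = mk⇔
  (toWitness {a? = i FinMembership.∈? c} ∘ subst T (VecP.lookup∘tabulate _ i))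
  (subst T (sym (VecP.lookup∘tabulate _ i)) ∘ fromWitness {a? = i FinMembership.∈? c})

any-clauseOf-characteristic : ∀ {n} (x : Vec Bool n) c →
                              any (lookup x) (clauseOf (characteristic c)) ≡ any (lookup x) c
any-clauseOf-characteristic x c = T-ext
  (SubsetP.any⁺ (lookup x) (Equivalence.to T-characteristic ∘ Equivalence.to (∈-clauseOf {v = characteristic c})))
  (SubsetP.any⁺ (lookup x) (Equivalence.from (∈-clauseOf {v = characteristic c}) ∘ Equivalence.from T-characteristic))

-- One clause per distinct variable set of φ, listed in the order of allInputs.
normalise : ∀ {n} → CNF n → CNF n
normalise {n} φ = map clauseOf (filter (_∈? map characteristic φ) (allInputs n))

∈-normalise : ∀ {n} {φ : CNF n} {c} → c ∈ φ → clauseOf (characteristic c) ∈ normalise φ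
∈-normalise {φ = φ} c∈ =
  ∈-map⁺ clauseOf (∈-filter⁺ (_∈? map characteristic φ) (∈-allInputs _) (∈-map⁺ characteristic c∈))

evalCNF-normalise : ∀ {n} (φ : CNF n) x → evalCNF (normalise φ) x ≡ evalCNF φ x
evalCNF-normalise {n} φ x = T-ext sat-φ sat-normalise
  where
  sat : List (Fin n) → Bool
  sat = any (lookup x)
  sat-φ : T (all sat (normalise φ)) → T (all sat φ)
  sat-φ t = AllP.all⁻ sat (All.tabulate λ {c} c∈ →
    subst T (any-clauseOf-characteristic x c) (All.lookup (AllP.all⁺ sat _ t) (∈-normalise c∈)))
  sat-normalise : T (all sat φ) → T (all sat (normalise φ))
  sat-normalise t = AllP.all⁻ sat (All.tabulate λ c∈ → clause (∈-map⁻ clauseOf c∈))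
    where
    clause : ∀ {c} → ∃ (λ v → v ∈ filter (_∈? map characteristic φ) (allInputs n) × c ≡ clauseOf v) → T (sat c)
    clause (v , v∈ , refl) with ∈-map⁻ characteristic (proj₂ (∈-filter⁻ _ {xs = allInputs n} v∈))
    ... | d , d∈φ , refl = subst T (sym (any-clauseOf-characteristic x d)) (All.lookup (AllP.all⁺ sat φ t) d∈φ)

length-normalise : ∀ {n} (φ : CNF n) → length (normalise φ) ℕ.≤ length φ
length-normalise {n} φ = begin
  length (map clauseOf (filter (_∈? cs) (allInputs n))) ≡⟨ ListP.length-map clauseOf (filter (_∈? cs) (allInputs n)) ⟩
  length (filter (_∈? cs) (allInputs n))                ≡⟨ length-filter≡count (_∈? cs) (allInputs n) ⟩
  count (λ v → does (v ∈? cs)) (allInputs n)            ≤⟨ Cube.count-∈?-≤ (allInputs-enumerates n) cs ⟩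
  length cs                                             ≡⟨ ListP.length-map characteristic φ ⟩
  length φ                                              ∎
  where
  open ℕP.≤-Reasoning
  cs = map characteristic φ

module _ {n} {f : Vec Bool n → Bool} (ν : Distribution f) where

  Pr-cong : ∀ {φ ψ : CNF n} → (∀ x → evalCNF φ x ≡ evalCNF ψ x) → Pr ν φ ≡ Pr ν ψ
  Pr-cong φ≗ψ = Sumℚ.∑-cong (λ x → cong (if_then mass ν x else 0ℚ) (φ≗ψ x)) (allInputs n)

  Pr-nonNeg : ∀ φ → 0ℚ ℚ.≤ Pr ν φ
  Pr-nonNeg φ = ∑ℚ-nonNeg term (allInputs n)
    where
    term : ∀ x → 0ℚ ℚ.≤ (if evalCNF φ x then mass ν x else 0ℚ)
    term x with evalCNF φ x
    ... | true  = nonneg ν x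
    ... | false = ℚP.≤-refl

  ratio≡Pr*inv : ∀ φ → ratio ν φ ≡ Pr ν φ ℚ.* inv (length φ)
  ratio≡Pr*inv []      = sym (ℚP.*-zeroʳ (Pr ν []))
  ratio≡Pr*inv (_ ∷ _) = refl

  ratio-nonNeg : ∀ φ → 0ℚ ℚ.≤ ratio ν φ
  ratio-nonNeg φ = subst (0ℚ ℚ.≤_) (sym (ratio≡Pr*inv φ)) (ℚP.nonNegative⁻¹ _ {{nonNeg-product}})
    where
    nonNeg-product = ℚP.nonNeg*nonNeg⇒nonNeg (Pr ν φ) {{ℚ.nonNegative (Pr-nonNeg φ)}}
                                             (inv (length φ)) {{ℚ.nonNegative (inv-nonNeg (length φ))}}

  ratio-normalise : ∀ φ → ratio ν φ ℚ.≤ ratio ν (normalise φ)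
  ratio-normalise []         = ratio-nonNeg (normalise [])
  ratio-normalise φ@(c ∷ cs) with normalise φ in eq | ∈-normalise {φ = φ} (here refl)
  ... | []     | ()
  ... | d ∷ ds | _ = begin
    Pr ν φ ℚ.* inv (suc (length cs))        ≤⟨ ℚP.*-monoˡ-≤-nonNeg (Pr ν φ) {{ℚ.nonNegative (Pr-nonNeg φ)}}
                                                 (inv-antitone shorter) ⟩
    Pr ν φ ℚ.* inv (suc (length ds))        ≡⟨ cong (ℚ._* inv (suc (length ds))) (Pr-cong {φ} {d ∷ ds} same-value) ⟩
    Pr ν (d ∷ ds) ℚ.* inv (suc (length ds)) ∎
    where
    open ℚP.≤-Reasoning
    shorter : length ds ℕ.≤ length cs
    shorter = ℕP.≤-pred (subst (λ ψ → length ψ ℕ.≤ suc (length cs)) eq (length-normalise φ))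
    same-value : ∀ x → evalCNF φ x ≡ evalCNF (d ∷ ds) x
    same-value x = trans (sym (evalCNF-normalise φ x)) (cong (λ ψ → evalCNF ψ x) eq)

sublists : List B → List (List B)
sublists []       = [] ∷ []
sublists (x ∷ xs) = map (x ∷_) (sublists xs) ++ sublists xs

filter∈sublists : ∀ {P : B → Set} (P? : Decidable P) xs → filter P? xs ∈ sublists xs
filter∈sublists P? []       = here refl
filter∈sublists P? (x ∷ xs) with does (P? x)
... | true  = ∈-++⁺ˡ (∈-map⁺ (x ∷_) (filter∈sublists P? xs))
... | false = ∈-++⁺ʳ (map (x ∷_) (sublists xs)) (filter∈sublists P? xs)

normalForms : ∀ n → List (CNF n)
normalForms n = map (map clauseOf) (sublists (allInputs n))

normalise∈normalForms : ∀ {n} (φ : CNF n) → normalise φ ∈ normalForms n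
normalise∈normalForms {n} φ = ∈-map⁺ (map clauseOf) (filter∈sublists (_∈? map characteristic φ) (allInputs n))

valid? : ∀ {n} (f : Vec Bool n → Bool) → Decidable (Valid f)
valid? {n} f φ = map′ (λ valid-on-all x → All.lookup valid-on-all (∈-allInputs x))
                      (λ valid → All.tabulate (λ {x} _ → valid x))
  (All.all? (λ x → (evalCNF φ x BoolP.≟ true) →-dec (f x BoolP.≟ true)) (allInputs n))

Valid-normalise : ∀ {n} {f : Vec Bool n → Bool} {φ} → Valid f φ → Valid f (normalise φ)
Valid-normalise {φ = φ} valid x φx = valid x (trans (sym (evalCNF-normalise φ x)) φx)

unsatisfiable : ∀ {n} → CNF n
unsatisfiable = [] ∷ []

unsatisfiable-valid : ∀ {n} (f : Vec Bool n → Bool) → Valid f unsatisfiable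
unsatisfiable-valid f x ()

bestCNF : ∀ {n} (f : Vec Bool n → Bool) → Distribution f → CNF n
bestCNF {n} f μ = argmax (ratio μ) unsatisfiable (filter (valid? f) (normalForms n))

IsDPlusμ-bestCNF : ∀ {n} (f : Vec Bool n → Bool) (μ : Distribution f) → IsDPlusμ f μ (ratio μ (bestCNF f μ))
IsDPlusμ-bestCNF {n} f μ = (bestCNF f μ , best-valid , refl) , best-≥
  where
  candidates = filter (valid? f) (normalForms n)
  best-valid : Valid f (bestCNF f μ)
  best-valid = argmax-all (ratio μ) {P = Valid f} (unsatisfiable-valid f) (AllP.all-filter (valid? f) (normalForms n))
  best-≥ : ∀ φ → Valid f φ → ratio μ φ ℚ.≤ ratio μ (bestCNF f μ)
  best-≥ φ valid = ℚP.≤-trans (ratio-normalise μ φ)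
    (All.lookup (f[xs]≤f[argmax] {f = ratio μ} unsatisfiable candidates)
                (∈-filter⁺ (valid? f) (normalise∈normalForms φ) (Valid-normalise {φ = φ} valid)))

IsDPlus-of-dominated : ∀ {n} {f : Vec Bool n → Bool} (μ : Distribution f) {d} → IsDPlusμ f μ d →
                       (∀ (ν : Distribution f) φ → Valid f φ → Σ (CNF n) λ ψ → Valid f ψ × ratio μ φ ℚ.≤ ratio ν ψ) →
                       IsDPlus f d
IsDPlus-of-dominated μ optimal@((φ* , φ*-valid , refl) , _) dominated = (μ , optimal) , minimal
  where
  minimal : ∀ ν d′ → IsDPlusμ _ ν d′ → ratio μ φ* ℚ.≤ d′
  minimal ν d′ (_ , ν-bound) =
    let ψ , ψ-valid , φ*≤ψ = dominated ν φ* φ*-valid in ℚP.≤-trans φ*≤ψ (ν-bound ψ ψ-valid)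

-- The uniform distribution on the middle layer

n≤2*⌈n/2⌉ : ∀ n → n ℕ.≤ 2 * ⌈ n /2⌉
n≤2*⌈n/2⌉ n = begin
  n                      ≡⟨ ℕP.⌊n/2⌋+⌈n/2⌉≡n n ⟨
  ℕ.⌊ n /2⌋ + ⌈ n /2⌉    ≤⟨ ℕP.+-monoˡ-≤ ⌈ n /2⌉ (ℕP.⌊n/2⌋≤⌈n/2⌉ n) ⟩
  ⌈ n /2⌉ + ⌈ n /2⌉      ≡⟨ cong (⌈ n /2⌉ +_) (ℕP.+-identityʳ ⌈ n /2⌉) ⟨
  2 * ⌈ n /2⌉            ∎
  where open ℕP.≤-Reasoning

n≤2*m⇒⌈n/2⌉≤m : ∀ {n m} → n ℕ.≤ 2 * m → ⌈ n /2⌉ ℕ.≤ m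
n≤2*m⇒⌈n/2⌉≤m {n} {m} n≤2m = begin
  ⌈ n /2⌉          ≤⟨ ℕP.⌈n/2⌉-mono n≤2m ⟩
  ⌈ 2 * m /2⌉      ≡⟨ cong ⌈_/2⌉ (cong (m +_) (ℕP.+-identityʳ m)) ⟩
  ⌈ m + m /2⌉      ≡⟨ ℕP.n≡⌈n+n/2⌉ m ⟨
  m                ∎
  where open ℕP.≤-Reasoning

Maj⇒⌈n/2⌉≤ones : ∀ {n} (x : Vec Bool n) → Maj n x ≡ true → ⌈ n /2⌉ ℕ.≤ ones x
Maj⇒⌈n/2⌉≤ones {n} x maj = n≤2*m⇒⌈n/2⌉≤m (ℕP.≤ᵇ⇒≤ n _ (Equivalence.from BoolP.T-≡ maj))

inLayer⇒Maj : ∀ {n} (x : Vec Bool n) → inLayer n x ≡ true → Maj n x ≡ true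
inLayer⇒Maj {n} x layer = Equivalence.to BoolP.T-≡ (ℕP.≤⇒≤ᵇ
  (subst (λ k → n ℕ.≤ 2 * k) (sym (ℕP.≡ᵇ⇒≡ (ones x) ⌈ n /2⌉ (Equivalence.from BoolP.T-≡ layer))) (n≤2*⌈n/2⌉ n)))

layerSize : ℕ → ℕ
layerSize n = count (inLayer n) (allInputs n)

layerSize≡suc : ∀ n → ∃ λ l → layerSize n ≡ suc l
layerSize≡suc n = ∈⇒count≡suc (∈-allInputs middle) (ℕP.≡⇒≡ᵇ _ _ (ones-keepOnes ⌈ n /2⌉ all-ones ⌈n/2⌉≤ones))
  where
  all-ones = Vec.replicate n true
  middle = keepOnes ⌈ n /2⌉ all-ones
  ones-replicate : ∀ n → ones (Vec.replicate n true) ≡ n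
  ones-replicate zero    = refl
  ones-replicate (suc n) = cong suc (ones-replicate n)
  ⌈n/2⌉≤ones : ⌈ n /2⌉ ℕ.≤ ones all-ones
  ⌈n/2⌉≤ones = subst (⌈ n /2⌉ ℕ.≤_) (sym (ones-replicate n)) (ℕP.⌈n/2⌉≤n n)

uniformMass≡ : ∀ n x → uniformMass n x ≡ (if inLayer n x then inv (layerSize n) else 0ℚ)
uniformMass≡ n x = cong (λ k → if inLayer n x then inv k else 0ℚ)
  (trans (length-filter≡count (T? ∘ inLayer n) (allInputs n))
         (Sumℕ.∑-cong (λ y → cong indicator (does-T? (inLayer n y))) (allInputs n)))
  where
  does-T? : ∀ b → does (T? b) ≡ b
  does-T? true  = refl
  does-T? false = refl

uniform : ∀ n → Distribution (Maj n)
uniform n = record { mass = uniformMass n ; nonneg = nonneg′ ; support = support′ ; total = total′ }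
  where
  nonneg′ : ∀ x → 0ℚ ℚ.≤ uniformMass n x
  nonneg′ x with inLayer n x
  ... | true  = inv-nonNeg (length (filter (T? ∘ inLayer n) (allInputs n)))
  ... | false = ℚP.≤-refl
  support′ : ∀ x → Maj n x ≡ false → uniformMass n x ≡ 0ℚ
  support′ x minority with inLayer n x in layer
  ... | true  = ⊥-elim (BoolP.not-¬ (inLayer⇒Maj x layer) minority)
  ... | false = refl
  total′ : sumℚ (map (uniformMass n) (allInputs n)) ≡ 1ℚ
  total′ with layerSize≡suc n
  ... | l , size≡ = begin
    ∑ℚ (uniformMass n) us                                        ≡⟨ Sumℚ.∑-cong (uniformMass≡ n) us ⟩
    ∑ℚ (λ x → if inLayer n x then inv (layerSize n) else 0ℚ) us ≡⟨ ∑ℚ-if (inLayer n) _ us ⟩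
    fromℕ (layerSize n) ℚ.* inv (layerSize n)                    ≡⟨ cong (λ k → fromℕ k ℚ.* inv k) size≡ ⟩
    fromℕ (suc l) ℚ.* inv (suc l)                                ≡⟨ fromℕ*inv l ⟩
    1ℚ                                                           ∎
    where
    open ≡-Reasoning
    us = allInputs n

satisfiedInLayer : ∀ {n} → CNF n → ℕ
satisfiedInLayer {n} φ = count (λ y → evalCNF φ y ∧ inLayer n y) (allInputs n)

Pr-uniform : ∀ {n} (φ : CNF n) → Pr (uniform n) φ ≡ fromℕ (satisfiedInLayer φ) ℚ.* inv (layerSize n)
Pr-uniform {n} φ = trans (Sumℚ.∑-cong term (allInputs n)) (∑ℚ-if (λ y → evalCNF φ y ∧ inLayer n y) _ (allInputs n))
  where
  term : ∀ x → (if evalCNF φ x then uniformMass n x else 0ℚ)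
               ≡ (if evalCNF φ x ∧ inLayer n x then inv (layerSize n) else 0ℚ)
  term x with evalCNF φ x
  ... | true  = uniformMass≡ n x
  ... | false = refl

-- Symmetrisation

satisfyingPermutations : ∀ {n} → CNF n → Vec Bool n → ℕ
satisfyingPermutations {n} φ x = count (λ π → evalCNF φ (act π x)) (permutations n)

∑-permutations-layer : ∀ {n} (x₀ : Vec Bool n) → ones x₀ ≡ ⌈ n /2⌉ → (h : Vec Bool n → ℕ) →
                       ∑ℕ (λ π → h (act π x₀)) (permutations n)
                       ≡ stabiliserOrder n ⌈ n /2⌉ * ∑ℕ (λ y → h y * indicator (inLayer n y)) (allInputs n)
∑-permutations-layer {n} x₀ middle h = trans (∑-permutations x₀ h)
  (subst (λ k → ∑ℕ h (arrangements x₀)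
                ≡ stabiliserOrder n k * ∑ℕ (λ y → h y * indicator (ones y ℕ.≡ᵇ k)) (allInputs n))
         middle (∑-arrangements x₀ h))

satisfyingPermutations-≥ : ∀ {n} (φ : CNF n) x → Maj n x ≡ true →
                           length (permutations n) * satisfiedInLayer φ ℕ.≤ layerSize n * satisfyingPermutations φ x
satisfyingPermutations-≥ {n} φ x maj = begin
  length (permutations n) * s    ≡⟨ cong (_* s) size-permutations ⟩
  (stab * L) * s                 ≡⟨ ℕP.*-assoc stab L s ⟩
  stab * (L * s)                 ≡⟨ x∙yz≈y∙xz stab L s ⟩
  L * (stab * s)                 ≡⟨ cong (L *_) satisfying-x₀ ⟨
  L * satisfyingPermutations φ x₀ ≤⟨ ℕP.*-monoʳ-≤ L (∑ℕ-mono-≤ x₀≤x (permutations n)) ⟩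
  L * satisfyingPermutations φ x ∎
  where
  open ℕP.≤-Reasoning
  open CommutativeSemigroupProperties ℕP.*-commutativeSemigroup using (x∙yz≈y∙xz)
  L = layerSize n
  s = satisfiedInLayer φ
  stab = stabiliserOrder n ⌈ n /2⌉
  x₀ = keepOnes ⌈ n /2⌉ x
  middle : ones x₀ ≡ ⌈ n /2⌉
  middle = ones-keepOnes ⌈ n /2⌉ x (Maj⇒⌈n/2⌉≤ones x maj)
  size-permutations : length (permutations n) ≡ stab * L
  size-permutations = trans (sym (count-true≡length (permutations n)))
    (trans (∑-permutations-layer x₀ middle (λ _ → 1))
           (cong (stab *_) (Sumℕ.∑-cong (λ y → ℕP.*-identityˡ (indicator (inLayer n y))) (allInputs n))))
  satisfying-x₀ : satisfyingPermutations φ x₀ ≡ stab * s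
  satisfying-x₀ = trans (∑-permutations-layer x₀ middle (indicator ∘ evalCNF φ))
    (cong (stab *_) (Sumℕ.∑-cong (λ y → sym (indicator-∧ (evalCNF φ y) (inLayer n y))) (allInputs n)))
  x₀≤x : ∀ π → indicator (evalCNF φ (act π x₀)) ℕ.≤ indicator (evalCNF φ (act π x))
  x₀≤x π = indicator-mono (evalCNF-mono φ {act π x₀} {act π x} (act-mono π {x₀} {x} (keepOnes-≤ᵛ ⌈ n /2⌉ x)))

Pr-uniform-≤-satisfyingPermutations : ∀ {n} (φ : CNF n) x → Maj n x ≡ true →
  fromℕ (length (permutations n)) ℚ.* Pr (uniform n) φ ℚ.≤ fromℕ (satisfyingPermutations φ x)
Pr-uniform-≤-satisfyingPermutations {n} φ x maj with layerSize≡suc n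
... | l , size≡ = begin
  fromℕ |P| ℚ.* Pr (uniform n) φ               ≡⟨ cong (fromℕ |P| ℚ.*_) (Pr-uniform φ) ⟩
  fromℕ |P| ℚ.* (fromℕ s ℚ.* inv L)            ≡⟨ ℚP.*-assoc (fromℕ |P|) (fromℕ s) (inv L) ⟨
  (fromℕ |P| ℚ.* fromℕ s) ℚ.* inv L            ≡⟨ cong (ℚ._* inv L) (fromℕ-* |P| s) ⟨
  fromℕ (|P| * s) ℚ.* inv L                    ≤⟨ ℚP.*-monoʳ-≤-nonNeg (inv L) {{ℚ.nonNegative (inv-nonNeg L)}}
                                                    (fromℕ-mono-≤ (satisfyingPermutations-≥ φ x maj)) ⟩
  fromℕ (L * c) ℚ.* inv L                      ≡⟨ cong (λ k → fromℕ (k * c) ℚ.* inv k) size≡ ⟩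
  fromℕ (suc l * c) ℚ.* inv (suc l)            ≡⟨ cong (ℚ._* inv (suc l)) (fromℕ-* (suc l) c) ⟩
  (fromℕ (suc l) ℚ.* fromℕ c) ℚ.* inv (suc l)  ≡⟨ cong (ℚ._* inv (suc l)) (ℚP.*-comm (fromℕ (suc l)) (fromℕ c)) ⟩
  (fromℕ c ℚ.* fromℕ (suc l)) ℚ.* inv (suc l)  ≡⟨ ℚP.*-assoc (fromℕ c) (fromℕ (suc l)) (inv (suc l)) ⟩
  fromℕ c ℚ.* (fromℕ (suc l) ℚ.* inv (suc l))  ≡⟨ cong (fromℕ c ℚ.*_) (fromℕ*inv l) ⟩
  fromℕ c ℚ.* 1ℚ                               ≡⟨ ℚP.*-identityʳ (fromℕ c) ⟩
  fromℕ c                                      ∎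
  where
  open ℚP.≤-Reasoning
  |P| = length (permutations n)
  L = layerSize n
  s = satisfiedInLayer φ
  c = satisfyingPermutations φ x

∑-Pr-relabel-≥ : ∀ {n} (ν : Distribution (Maj n)) (φ : CNF n) →
                 fromℕ (length (permutations n)) ℚ.* Pr (uniform n) φ
                 ℚ.≤ ∑ℚ (λ π → Pr ν (relabel π φ)) (permutations n)
∑-Pr-relabel-≥ {n} ν φ = begin
  r                                                             ≡⟨ ℚP.*-identityʳ r ⟨
  r ℚ.* 1ℚ                                                      ≡⟨ cong (r ℚ.*_) (total ν) ⟨
  r ℚ.* ∑ℚ (mass ν) us                                          ≡⟨ Sumℚ.∑-distribˡ r (mass ν) us ⟨
  ∑ℚ (λ x → r ℚ.* mass ν x) us                                  ≤⟨ ∑ℚ-mono-≤ weighted us ⟩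
  ∑ℚ (λ x → fromℕ (satisfyingPermutations φ x) ℚ.* mass ν x) us ≡⟨ Sumℚ.∑-cong as-sum us ⟩
  ∑ℚ (λ x → ∑ℚ (λ π → term π x) P) us                           ≡⟨ Sumℚ.∑-swap (λ x π → term π x) us P ⟩
  ∑ℚ (λ π → ∑ℚ (term π) us) P                                   ≡⟨ Sumℚ.∑-cong relabelled P ⟨
  ∑ℚ (λ π → Pr ν (relabel π φ)) P                               ∎
  where
  open ℚP.≤-Reasoning
  us = allInputs n
  P = permutations n
  r = fromℕ (length P) ℚ.* Pr (uniform n) φ
  term : Vec (Fin n) n → Vec Bool n → ℚ
  term π x = if evalCNF φ (act π x) then mass ν x else 0ℚ
  weighted : ∀ x → r ℚ.* mass ν x ℚ.≤ fromℕ (satisfyingPermutations φ x) ℚ.* mass ν x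
  weighted x with Maj n x in maj
  ... | true  = ℚP.*-monoʳ-≤-nonNeg (mass ν x) {{ℚ.nonNegative (nonneg ν x)}}
                                    (Pr-uniform-≤-satisfyingPermutations φ x maj)
  ... | false = ℚP.≤-reflexive (begin-equality
    r ℚ.* mass ν x                                   ≡⟨ cong (r ℚ.*_) (support ν x maj) ⟩
    r ℚ.* 0ℚ                                         ≡⟨ ℚP.*-zeroʳ r ⟩
    0ℚ                                               ≡⟨ ℚP.*-zeroʳ (fromℕ (satisfyingPermutations φ x)) ⟨
    fromℕ (satisfyingPermutations φ x) ℚ.* 0ℚ
      ≡⟨ cong (fromℕ (satisfyingPermutations φ x) ℚ.*_) (support ν x maj) ⟨
    fromℕ (satisfyingPermutations φ x) ℚ.* mass ν x  ∎)
  as-sum : ∀ x → fromℕ (satisfyingPermutations φ x) ℚ.* mass ν x ≡ ∑ℚ (λ π → term π x) P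
  as-sum x = sym (∑ℚ-if (λ π → evalCNF φ (act π x)) (mass ν x) P)
  relabelled : ∀ π → Pr ν (relabel π φ) ≡ ∑ℚ (term π) us
  relabelled π = Sumℚ.∑-cong (λ x → cong (if_then mass ν x else 0ℚ) (evalCNF-relabel π φ x)) us

symmetrise : ∀ {n} (ν : Distribution (Maj n)) (φ : CNF n) → Valid (Maj n) φ →
             Σ (CNF n) λ ψ → Valid (Maj n) ψ × ratio (uniform n) φ ℚ.≤ ratio ν ψ
symmetrise {n} ν φ valid = relabel π φ , Valid-relabel π φ (λ x → Maj-act x π-perm) valid , ratio-≤
  where
  P = permutations n
  g : Vec (Fin n) n → ℚ
  g π = Pr ν (relabel π φ)
  π = argmax g (allFin n) P
  π-perm : π ∈ P
  π-perm = argmax-all g {P = _∈ P} (∈-arrangements (allFin n)) (All.tabulate (λ π∈ → π∈))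
  -- The best relabelling does at least as well as the average over all of them.
  Pr-≤ : Pr (uniform n) φ ℚ.≤ g π
  Pr-≤ with ∈⇒count≡suc {p = λ _ → true} (∈-arrangements (allFin n)) _
  ... | k , size≡ = ℚP.*-cancelˡ-≤-pos (fromℕ (suc k))
    (subst (λ m → fromℕ m ℚ.* Pr (uniform n) φ ℚ.≤ fromℕ m ℚ.* g π) (trans (sym (count-true≡length P)) size≡)
      (ℚP.≤-trans (∑-Pr-relabel-≥ ν φ) (∑ℚ-≤-length* g (g π) P (f[xs]≤f[argmax] (allFin n) P))))
  ratio-≤ : ratio (uniform n) φ ℚ.≤ ratio ν (relabel π φ)
  ratio-≤ = begin
    ratio (uniform n) φ                   ≡⟨ ratio≡Pr*inv (uniform n) φ ⟩
    Pr (uniform n) φ ℚ.* inv (length φ)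
      ≤⟨ ℚP.*-monoʳ-≤-nonNeg (inv (length φ)) {{ℚ.nonNegative (inv-nonNeg (length φ))}} Pr-≤ ⟩
    g π ℚ.* inv (length φ)                ≡⟨ cong (λ k → g π ℚ.* inv k) (ListP.length-map (map (lookup π)) φ) ⟨
    g π ℚ.* inv (length (relabel π φ))    ≡⟨ ratio≡Pr*inv ν (relabel π φ) ⟨
    ratio ν (relabel π φ)                 ∎
    where open ℚP.≤-Reasoning

proposition3p4 : (n : ℕ) → Σ (Distribution (Maj n)) λ μ → (∀ x → mass μ x ≡ uniformMass n x)
                   × Σ ℚ λ d → IsDPlusμ (Maj n) μ d × IsDPlus (Maj n) d
proposition3p4 n = uniform n , (λ _ → refl) , _ , optimal , IsDPlus-of-dominated (uniform n) optimal symmetrise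
  where
  optimal : IsDPlusμ (Maj n) (uniform n) (ratio (uniform n) (bestCNF (Maj n) (uniform n)))
  optimal = IsDPlusμ-bestCNF (Maj n) (uniform n)
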